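{- Let $G$ be a graph that does not contain the complete bipartite graph $K_{t,t}$ as a subgraph, and let $X\subseteq V(G)$ have rank at most $r$ in $G$. Then $X$ is captured by some separation of $G$ of order at most $2^{r+1}(t-1)$.
   Context: Graphs are finite, simple, undirected. The rank of $X\subseteq V(G)$ is the rank over $\mathbb F_2$ of the $\{0,1\}$ adjacency matrix with rows indexed by $X$ and columns by $V(G)\setminus X$. A separation of $G$ is a pair $(L,R)$ of vertex subsets with $L\cup R=V(G)$ and no edge between $L\setminus R$ and $R\setminus L$; its order is $|L\cap R|$. A set $X$ is captured by $(L,R)$ if $L\setminus R\subseteq X\subseteq L$. -}

module Defs where

open import Data.Nat using (ℕ; _≤_; _^_; _*_; _∸_; suc)
open import Data.Bool using (Bool; true; false; _∧_; _xor_; not)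
open import Data.Fin using (Fin)
open import Data.Fin.Subset using (Subset; _∈_; _∉_; _⊆_; _∩_; _∪_; _─_; ⊤; ∣_∣; Nonempty)
open import Data.Vec using (lookup)
open import Data.List using (foldr; allFin)
open import Data.Product using (Σ; ∃; _×_)
open import Relation.Binary.PropositionalEquality using (_≡_; _≢_)
open import Relation.Nullary using (¬_)

record Graph (n : ℕ) : Set where
  field
    adj   : Fin n → Fin n → Bool
    sym   : ∀ u v → adj u v ≡ adj v u
    irrefl : ∀ v → adj v v ≡ false

open Graph public

-- G contains K_{t,t} as a (not necessarily induced) subgraph:
-- two injective families a, b : Fin t → V(G) with a i adjacent to b j
-- for all i, j (so the two sides are automatically disjoint, as the
-- graph is loopless).
ContainsKtt : ∀ {n} → Graph n → ℕ → Set
ContainsKtt {n} G t =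
  Σ (Fin t → Fin n) λ a → Σ (Fin t → Fin n) λ b →
    (∀ i j → a i ≡ a j → i ≡ j) ×
    (∀ i j → b i ≡ b j → i ≡ j) ×
    (∀ i j → adj G (a i) (b j) ≡ true)

-- The row of the X × (V ∖ X) adjacency matrix indexed by x, as a vector
-- over F₂ = Bool indexed by the columns y ∈ V ∖ X.  (We index it by all
-- of Fin n and put 0 in the columns y ∈ X; this only adds zero
-- coordinates, which does not affect linear (in)dependence.)
cutRow : ∀ {n} → Graph n → Subset n → Fin n → Fin n → Bool
cutRow G X x y = adj G x y ∧ not (lookup X y)

rowSum : ∀ {n} → Graph n → Subset n → Subset n → Fin n → Bool
rowSum {n} G X S y =
  foldr (λ x acc → (lookup S x ∧ cutRow G X x y) xor acc) false (allFin n)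

RowsIndependent : ∀ {n} → Graph n → Subset n → Subset n → Set
RowsIndependent G X S =
  ∀ T → T ⊆ S → Nonempty T → ∃ λ y → rowSum G X T y ≡ true

RankAtMost : ∀ {n} → Graph n → Subset n → ℕ → Set
RankAtMost G X r = ∀ S → S ⊆ X → RowsIndependent G X S → ∣ S ∣ ≤ r

IsSeparation : ∀ {n} → Graph n → Subset n → Subset n → Set
IsSeparation {n} G L R =
  (∀ v → v ∈ L ∪ R) ×
  (∀ u v → u ∈ L ─ R → v ∈ R ─ L → adj G u v ≡ false)

order : ∀ {n} → Subset n → Subset n → ℕ
order L R = ∣ L ∩ R ∣

Captured : ∀ {n} → Subset n → Subset n → Subset n → Set
Captured X L R = (L ─ R) ⊆ X × X ⊆ L

{-# OPTIONS --safe #-}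
module Submission where

-- Greedily choose vertices b₁ … b_k of X whose rows in the X × (V ∖ X) matrix are
-- independent and span the rows of all of X; by the rank bound k ≤ r.  Splitting on whether
-- bᵢ is used to express a row, one bᵢ at a time, partitions X into at most 2^k classes of
-- vertices with one common row c.  If such a class and the support of c both had at least
-- t elements they would form a K_{t,t}; so one of the two has fewer than t vertices, and it
-- meets every edge from the class to V ∖ X.  The union S of these sets has |S| ≤ 2^r (t − 1),
-- and (X ∪ S, (V ∖ X) ∪ S) is a separation capturing X with L ∩ R = S.

open import Defs hiding (sym)
open import Algebra.Bundles using (CommutativeRing)
open import Data.Bool using (Bool; true; false; _∧_; _xor_; not)
open import Data.Bool.Properties
  using (xor-identityʳ; xor-assoc; ∧-identityʳ; ∧-zeroʳ; ∧-distribʳ-xor; ¬-not;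
         xor-∧-commutativeRing)
  renaming (_≟_ to _≟ᵇ_)
open import Data.Fin using (Fin; zero; suc; _≟_)
open import Data.Fin.Properties using (all?; any?) renaming (suc-injective to Fin-suc-injective)
open import Data.Fin.Subset
  using (Subset; _∈_; _∉_; _⊆_; _∩_; _∪_; _─_; _-_; ∁; ⁅_⁆; ⊥; ∣_∣; inside; outside)
open import Data.Fin.Subset.Properties
  using (_∈?_; ∉⊥; ⊥⊆; p⊆p∪q; x∈p∪q⁻; x∈p∪q⁺; x∈p∩q⁻; x∈⁅x⁆; x∈⁅y⁆⇒x≡y; x≢y⇒x∉⁅y⁆;
         p─q⊆p; x∈p∧x≢y⇒x∈p-y; p⊂q⇒∣p∣<∣q∣; p⊆q⇒∣p∣≤∣q∣; x∉p⇒x∈∁p; x∈∁p⇒x∉p)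
open import Data.List using (List; []; _∷_; foldr; allFin; tabulate; length)
open import Data.List.Membership.Propositional using () renaming (_∈_ to _∈ₗ_)
open import Data.List.Membership.Propositional.Properties using (∈-allFin)
open import Data.List.Properties using (foldr-cong)
open import Data.List.Relation.Unary.Any using (here; there)
open import Data.Nat using (ℕ; zero; suc; _≤_; _<_; _+_; _*_; _^_; _∸_; z≤n; s≤s; _≤?_)
open import Data.Nat.Properties
  using (≤-trans; ≤-reflexive; +-mono-≤; +-monoʳ-≤; +-suc; +-identityʳ; *-identityˡ; *-assoc;
         *-monoˡ-≤; ^-monoʳ-≤; m≤m+n; n≤1+n; ≰⇒>; module ≤-Reasoning)
open import Data.Product using (Σ; ∃; _×_; _,_)
open import Data.Sum using (_⊎_; inj₁; inj₂; [_,_]′)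
open import Data.Vec using ([]; _∷_; lookup; here; there)
open import Data.Vec.Properties using (lookup⇒[]=; []=⇒lookup; lookup∘tabulate; lookup-replicate)
open import Data.Vec.Functional using (Vector; replicate; zipWith)
open import Function using (_∘_)
open import Level using (0ℓ)
open import Relation.Binary.PropositionalEquality
  using (_≡_; refl; sym; trans; cong; subst; _≗_; module ≡-Reasoning)
open import Relation.Nullary using (¬_; Dec; yes; no; does; contradiction)
open import Relation.Nullary.Decidable using (_⊎-dec_; dec-true)
open import Relation.Unary using (Pred; Decidable)

open import Algebra.Properties.CommutativeSemigroup
  (CommutativeRing.+-commutativeSemigroup xor-∧-commutativeRing)
  using () renaming (interchange to xor-interchange)

xorSum : {A : Set} → (A → Bool) → List A → Bool
xorSum f = foldr (λ x acc → f x xor acc) false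

module _ {A : Set} where

  xorSum-cong : {f g : A → Bool} → f ≗ g → xorSum f ≗ xorSum g
  xorSum-cong f≗g = foldr-cong (λ x acc → cong (_xor acc) (f≗g x)) refl

  xorSum-xor : (f g : A → Bool) (xs : List A) →
               xorSum (λ x → f x xor g x) xs ≡ xorSum f xs xor xorSum g xs
  xorSum-xor f g []       = refl
  xorSum-xor f g (x ∷ xs) =
    trans (cong ((f x xor g x) xor_) (xorSum-xor f g xs)) (xor-interchange (f x) (g x) _ _)

  xorSum-false : {f : A → Bool} → (∀ x → f x ≡ false) → (xs : List A) → xorSum f xs ≡ false
  xorSum-false f≡false []       = refl
  xorSum-false f≡false (x ∷ xs) rewrite f≡false x = xorSum-false f≡false xs

xorSum-tabulate : ∀ {A : Set} {n} (f : A → Bool) (g : Fin n → A) →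
                  xorSum f (tabulate g) ≡ xorSum (f ∘ g) (allFin n)
xorSum-tabulate {n = zero}  f g = refl
xorSum-tabulate {n = suc n} f g = cong (f (g zero) xor_) (begin
  xorSum f (tabulate (g ∘ suc))     ≡⟨ xorSum-tabulate f (g ∘ suc) ⟩
  xorSum (f ∘ g ∘ suc) (allFin n)   ≡⟨ xorSum-tabulate (f ∘ g) suc ⟨
  xorSum (f ∘ g) (tabulate suc)     ∎)
  where open ≡-Reasoning

xorSum-⁅⁆ : ∀ {n} (f : Fin n → Bool) (v : Fin n) →
            xorSum (λ x → lookup ⁅ v ⁆ x ∧ f x) (allFin n) ≡ f v
xorSum-⁅⁆ {suc n} f zero = begin
  f zero xor xorSum (λ x → lookup ⁅ zero ⁆ x ∧ f x) (tabulate suc)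
    ≡⟨ cong (f zero xor_) (xorSum-tabulate (λ x → lookup ⁅ zero ⁆ x ∧ f x) suc) ⟩
  f zero xor xorSum (λ x → lookup ⊥ x ∧ f (suc x)) (allFin n)
    ≡⟨ cong (f zero xor_) (xorSum-false ⊥-terms (allFin n)) ⟩
  f zero xor false
    ≡⟨ xor-identityʳ (f zero) ⟩
  f zero ∎
  where
  open ≡-Reasoning
  ⊥-terms : ∀ x → lookup ⊥ x ∧ f (suc x) ≡ false
  ⊥-terms x = cong (_∧ f (suc x)) (lookup-replicate x false)
xorSum-⁅⁆ {suc n} f (suc v) =
  trans (xorSum-tabulate (λ x → lookup ⁅ suc v ⁆ x ∧ f x) suc) (xorSum-⁅⁆ (f ∘ suc) v)

xor≡false⇒≡ : ∀ {a b} → a xor b ≡ false → a ≡ b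
xor≡false⇒≡ {false} {false} _ = refl
xor≡false⇒≡ {true}  {true}  _ = refl

∧≡true⇒ˡ : ∀ {a b} → a ∧ b ≡ true → a ≡ true
∧≡true⇒ˡ {true} _ = refl

0ᵥ : ∀ {n} → Vector Bool n
0ᵥ = replicate _ false

infixl 6 _⊕_
_⊕_ : ∀ {n} → Vector Bool n → Vector Bool n → Vector Bool n
_⊕_ = zipWith _xor_

_≗?_ : ∀ {n} (u w : Vector Bool n) → Dec (u ≗ w)
u ≗? w = all? (λ y → u y ≟ᵇ w y)

someTrue⊎≗0ᵥ : ∀ {n} (u : Vector Bool n) → (∃ λ y → u y ≡ true) ⊎ u ≗ 0ᵥ
someTrue⊎≗0ᵥ u with any? (λ y → u y ≟ᵇ true)
... | yes ∃true = inj₁ ∃true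
... | no  ∄true = inj₂ (λ y → ¬-not (∄true ∘ (y ,_)))

module _ {n : ℕ} {P : Pred (Fin n) 0ℓ} (P? : Decidable P) where

  subsetOf : Subset n
  subsetOf = Data.Vec.tabulate (does ∘ P?)

  ∈-subsetOf⁺ : ∀ {x} → P x → x ∈ subsetOf
  ∈-subsetOf⁺ {x} px =
    lookup⇒[]= x subsetOf (trans (lookup∘tabulate (does ∘ P?) x) (dec-true (P? x) px))

  ∈-subsetOf⁻ : ∀ {x} → x ∈ subsetOf → P x
  ∈-subsetOf⁻ {x} x∈ with P? x | trans (sym (lookup∘tabulate (does ∘ P?) x)) ([]=⇒lookup x∈)
  ... | yes px | _ = px

support : ∀ {n} → Vector Bool n → Subset n
support u = subsetOf (λ y → u y ≟ᵇ true)

∈-support⁻ : ∀ {n} {u : Vector Bool n} {y} → y ∈ support u → u y ≡ true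
∈-support⁻ {u = u} = ∈-subsetOf⁻ (λ y → u y ≟ᵇ true)

∉-support⁻ : ∀ {n} {u : Vector Bool n} {y} → y ∉ support u → u y ≡ false
∉-support⁻ {u = u} y∉ = ¬-not (y∉ ∘ ∈-subsetOf⁺ (λ y → u y ≟ᵇ true))

∉⇒lookup≡false : ∀ {n} {x : Fin n} {p : Subset n} → x ∉ p → lookup p x ≡ false
∉⇒lookup≡false {x = x} {p} x∉p = ¬-not (x∉p ∘ lookup⇒[]= x p)

lookup-─ : ∀ {n} (p q : Subset n) (x : Fin n) → lookup (p ─ q) x ≡ lookup p x ∧ not (lookup q x)
lookup-─ (a ∷ p) (outside ∷ q) zero    = sym (∧-identityʳ a)
lookup-─ (a ∷ p) (inside  ∷ q) zero    = sym (∧-zeroʳ a)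
lookup-─ (_ ∷ p) (_       ∷ q) (suc x) = lookup-─ p q x

lookup≡⁅v⁆xor[p-v] : ∀ {n} {v : Fin n} {p : Subset n} → v ∈ p →
                     ∀ x → lookup p x ≡ lookup ⁅ v ⁆ x xor lookup (p - v) x
lookup≡⁅v⁆xor[p-v] {v = v} {p} v∈p x with x ≟ v
... | yes refl rewrite lookup-─ p ⁅ x ⁆ x | []=⇒lookup v∈p | []=⇒lookup (x∈⁅x⁆ x) = refl
... | no x≢v   rewrite lookup-─ p ⁅ v ⁆ x | ∉⇒lookup≡false (x≢y⇒x∉⁅y⁆ x≢v) =
  sym (∧-identityʳ (lookup p x))

x∈p─q⇒x∉q : ∀ {n} {x : Fin n} {p q : Subset n} → x ∈ p ─ q → x ∉ q
x∈p─q⇒x∉q {p = _ ∷ _} {outside ∷ _} here ()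
x∈p─q⇒x∉q {p = _ ∷ _} {_ ∷ _} (there x∈p─q) (there x∈q) = x∈p─q⇒x∉q x∈p─q x∈q

⁅x⁆⊆p : ∀ {n} {x : Fin n} {p : Subset n} → x ∈ p → ⁅ x ⁆ ⊆ p
⁅x⁆⊆p {x = x} {p} x∈p y∈⁅x⁆ = subst (_∈ p) (sym (x∈⁅y⁆⇒x≡y x y∈⁅x⁆)) x∈p

module _ {n : ℕ} {p q : Subset n} {v : Fin n} where

  ⊆∪⁅⁆⇒-⊆ : p ⊆ q ∪ ⁅ v ⁆ → p - v ⊆ q
  ⊆∪⁅⁆⇒-⊆ p⊆q∪v {x} x∈p-v with x∈p∪q⁻ q ⁅ v ⁆ (p⊆q∪v (p─q⊆p p ⁅ v ⁆ x∈p-v))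
  ... | inj₁ x∈q = x∈q
  ... | inj₂ x∈v = contradiction x∈v (x∈p─q⇒x∉q x∈p-v)

  ⊆∪⁅⁆∧∉⇒⊆ : p ⊆ q ∪ ⁅ v ⁆ → v ∉ p → p ⊆ q
  ⊆∪⁅⁆∧∉⇒⊆ p⊆q∪v v∉p x∈p = ⊆∪⁅⁆⇒-⊆ p⊆q∪v (x∈p∧x≢y⇒x∈p-y x∈p λ { refl → v∉p x∈p })

∣p∪q∣≤∣p∣+∣q∣ : ∀ {n} (p q : Subset n) → ∣ p ∪ q ∣ ≤ ∣ p ∣ + ∣ q ∣
∣p∪q∣≤∣p∣+∣q∣ []            []            = z≤n
∣p∪q∣≤∣p∣+∣q∣ (outside ∷ p) (outside ∷ q) = ∣p∪q∣≤∣p∣+∣q∣ p q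
∣p∪q∣≤∣p∣+∣q∣ (inside  ∷ p) (outside ∷ q) = s≤s (∣p∪q∣≤∣p∣+∣q∣ p q)
∣p∪q∣≤∣p∣+∣q∣ (outside ∷ p) (inside  ∷ q) =
  ≤-trans (s≤s (∣p∪q∣≤∣p∣+∣q∣ p q)) (≤-reflexive (sym (+-suc ∣ p ∣ ∣ q ∣)))
∣p∪q∣≤∣p∣+∣q∣ (inside  ∷ p) (inside  ∷ q) =
  s≤s (≤-trans (∣p∪q∣≤∣p∣+∣q∣ p q) (+-monoʳ-≤ ∣ p ∣ (n≤1+n ∣ q ∣)))

x∉p⇒∣p∣<∣p∪⁅x⁆∣ : ∀ {n} {x : Fin n} {p : Subset n} → x ∉ p → ∣ p ∣ < ∣ p ∪ ⁅ x ⁆ ∣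
x∉p⇒∣p∣<∣p∪⁅x⁆∣ {x = x} x∉p = p⊂q⇒∣p∣<∣q∣ (p⊆p∪q ⁅ x ⁆ , x , x∈p∪q⁺ (inj₂ (x∈⁅x⁆ x)) , x∉p)

choose : ∀ {n t} (p : Subset n) → t ≤ ∣ p ∣ →
         Σ (Fin t → Fin n) λ f → (∀ i j → f i ≡ f j → i ≡ j) × (∀ i → f i ∈ p)
choose {t = zero}  p _ = (λ ()) , (λ ()) , (λ ())
choose {t = suc t} (outside ∷ p) t≤∣p∣ with choose p t≤∣p∣
... | f , f-inj , f∈p = suc ∘ f , (λ i j → f-inj i j ∘ Fin-suc-injective) , there ∘ f∈p
choose {t = suc t} (inside ∷ p) (s≤s t≤∣p∣) with choose p t≤∣p∣
... | f , f-inj , f∈p = g , g-inj , g∈p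
  where
  g : Fin (suc t) → Fin _
  g zero    = zero
  g (suc i) = suc (f i)

  g-inj : ∀ i j → g i ≡ g j → i ≡ j
  g-inj zero    zero    _     = refl
  g-inj (suc i) (suc j) gi≡gj = cong suc (f-inj i j (Fin-suc-injective gi≡gj))

  g∈p : ∀ i → g i ∈ inside ∷ p
  g∈p zero    = here
  g∈p (suc i) = there (f∈p i)

m≰n∸1⇒n≤m : ∀ {m} n → ¬ m ≤ n ∸ 1 → n ≤ m
m≰n∸1⇒n≤m zero    _   = z≤n
m≰n∸1⇒n≤m (suc n) m≰n = ≰⇒> m≰n

completeBetween⇒ContainsKtt : ∀ {n t} (G : Graph n) {A B : Subset n} →
  t ≤ ∣ A ∣ → t ≤ ∣ B ∣ → (∀ {x y} → x ∈ A → y ∈ B → adj G x y ≡ true) → ContainsKtt G t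
completeBetween⇒ContainsKtt G t≤∣A∣ t≤∣B∣ complete with choose _ t≤∣A∣ | choose _ t≤∣B∣
... | a , a-inj , a∈A | b , b-inj , b∈B =
  a , b , a-inj , b-inj , λ i j → complete (a∈A i) (b∈B j)

module _ {n : ℕ} (G : Graph n) (X : Subset n) where

  rowSum-xor : ∀ {T P Q : Subset n} → (∀ x → lookup T x ≡ lookup P x xor lookup Q x) →
               rowSum G X T ≗ rowSum G X P ⊕ rowSum G X Q
  rowSum-xor {T} {P} {Q} T≡P⊕Q y = begin
    xorSum (weighted T) (allFin n)
      ≡⟨ xorSum-cong distrib (allFin n) ⟩
    xorSum (λ x → weighted P x xor weighted Q x) (allFin n)
      ≡⟨ xorSum-xor (weighted P) (weighted Q) (allFin n) ⟩
    rowSum G X P y xor rowSum G X Q y ∎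
    where
    open ≡-Reasoning
    weighted : Subset n → Fin n → Bool
    weighted S x = lookup S x ∧ cutRow G X x y

    distrib : weighted T ≗ λ x → weighted P x xor weighted Q x
    distrib x = trans (cong (_∧ cutRow G X x y) (T≡P⊕Q x))
                      (∧-distribʳ-xor (cutRow G X x y) (lookup P x) (lookup Q x))

  rowSum-empty : ∀ {T : Subset n} → (∀ x → lookup T x ≡ false) → rowSum G X T ≗ 0ᵥ
  rowSum-empty T≡false y = xorSum-false (λ x → cong (_∧ cutRow G X x y) (T≡false x)) (allFin n)

  rowSum-⁅⁆ : ∀ v → rowSum G X ⁅ v ⁆ ≗ cutRow G X v
  rowSum-⁅⁆ v y = xorSum-⁅⁆ (λ x → cutRow G X x y) v

  rowSum-split : ∀ {v} {T : Subset n} → v ∈ T →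
                 rowSum G X T ≗ cutRow G X v ⊕ rowSum G X (T - v)
  rowSum-split {v} {T} v∈T y =
    trans (rowSum-xor {T} {⁅ v ⁆} {T - v} (lookup≡⁅v⁆xor[p-v] v∈T) y)
          (cong (_xor rowSum G X (T - v) y) (rowSum-⁅⁆ v y))

  -- u ∈ c + span {cutRow G X b ∣ b ∈ bs}, unfolded by whether the first row is used.
  InCoset : Vector Bool n → List (Fin n) → Vector Bool n → Set
  InCoset c []       u = u ≗ c
  InCoset c (b ∷ bs) u = InCoset c bs u ⊎ InCoset (c ⊕ cutRow G X b) bs u

  inCoset? : ∀ c bs u → Dec (InCoset c bs u)
  inCoset? c []       u = u ≗? c
  inCoset? c (b ∷ bs) u = inCoset? c bs u ⊎-dec inCoset? (c ⊕ cutRow G X b) bs u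

  InCoset-refl : ∀ c bs → InCoset c bs c
  InCoset-refl c []       _ = refl
  InCoset-refl c (b ∷ bs)   = inj₁ (InCoset-refl c bs)

  InCoset-resp : ∀ c bs {u w} → u ≗ w → InCoset c bs u → InCoset c bs w
  InCoset-resp c []       u≗w u≗c y     = trans (sym (u≗w y)) (u≗c y)
  InCoset-resp c (b ∷ bs) u≗w (inj₁ u∈) = inj₁ (InCoset-resp c bs u≗w u∈)
  InCoset-resp c (b ∷ bs) u≗w (inj₂ u∈) = inj₂ (InCoset-resp (c ⊕ cutRow G X b) bs u≗w u∈)

  rowClass : Vector Bool n → Subset n
  rowClass c = subsetOf (λ x → cutRow G X x ≗? c)

  ∈-rowClass⁺ : ∀ {c x} → cutRow G X x ≗ c → x ∈ rowClass c
  ∈-rowClass⁺ {c} = ∈-subsetOf⁺ (λ x → cutRow G X x ≗? c)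

  ∈-rowClass⁻ : ∀ {c x} → x ∈ rowClass c → cutRow G X x ≗ c
  ∈-rowClass⁻ {c} = ∈-subsetOf⁻ (λ x → cutRow G X x ≗? c)

  CutCover : Pred (Fin n) 0ℓ → Subset n → Set
  CutCover P S = ∀ {x y} → P x → x ∉ S → y ∉ S → cutRow G X x y ≡ false

  module _ {t : ℕ} (noKtt : ¬ ContainsKtt G t) where

    identicalRows-cover : (c : Vector Bool n) →
      ∃ λ S → ∣ S ∣ ≤ t ∸ 1 × CutCover (λ x → cutRow G X x ≗ c) S
    identicalRows-cover c with ∣ rowClass c ∣ ≤? t ∸ 1 | ∣ support c ∣ ≤? t ∸ 1
    ... | yes fewVertices | _ =
      rowClass c , fewVertices , λ x∈class x∉ _ → contradiction (∈-rowClass⁺ x∈class) x∉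
    ... | no _ | yes fewNeighbours =
      support c , fewNeighbours , λ x∈class _ y∉ → trans (x∈class _) (∉-support⁻ {u = c} y∉)
    ... | no manyVertices | no manyNeighbours = contradiction Ktt noKtt
      where
      complete : ∀ {x y} → x ∈ rowClass c → y ∈ support c → adj G x y ≡ true
      complete {y = y} x∈ y∈ = ∧≡true⇒ˡ (trans (∈-rowClass⁻ x∈ y) (∈-support⁻ {u = c} y∈))

      Ktt : ContainsKtt G t
      Ktt = completeBetween⇒ContainsKtt G
              (m≰n∸1⇒n≤m t manyVertices) (m≰n∸1⇒n≤m t manyNeighbours) complete

    cosetCover : ∀ bs c →
      ∃ λ S → ∣ S ∣ ≤ 2 ^ length bs * (t ∸ 1) × CutCover (InCoset c bs ∘ cutRow G X) S
    cosetCover [] c with identicalRows-cover c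
    ... | S , ∣S∣≤ , cover = S , ≤-trans ∣S∣≤ (≤-reflexive (sym (*-identityˡ (t ∸ 1)))) , cover
    cosetCover (b ∷ bs) c with cosetCover bs c | cosetCover bs (c ⊕ cutRow G X b)
    ... | S₁ , ∣S₁∣≤ , cover₁ | S₂ , ∣S₂∣≤ , cover₂ = S₁ ∪ S₂ , size , cover
      where
      size : ∣ S₁ ∪ S₂ ∣ ≤ 2 ^ suc (length bs) * (t ∸ 1)
      size = begin
        ∣ S₁ ∪ S₂ ∣                    ≤⟨ ∣p∪q∣≤∣p∣+∣q∣ S₁ S₂ ⟩
        ∣ S₁ ∣ + ∣ S₂ ∣                ≤⟨ +-mono-≤ ∣S₁∣≤ ∣S₂∣≤ ⟩
        a + a                          ≡⟨ cong (a +_) (+-identityʳ a) ⟨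
        2 * a                          ≡⟨ *-assoc 2 (2 ^ length bs) (t ∸ 1) ⟨
        2 ^ suc (length bs) * (t ∸ 1)  ∎
        where
        open ≤-Reasoning
        a = 2 ^ length bs * (t ∸ 1)

      cover : CutCover (InCoset c (b ∷ bs) ∘ cutRow G X) (S₁ ∪ S₂)
      cover (inj₁ x∈) x∉ y∉ = cover₁ x∈ (x∉ ∘ x∈p∪q⁺ ∘ inj₁) (y∉ ∘ x∈p∪q⁺ ∘ inj₁)
      cover (inj₂ x∈) x∉ y∉ = cover₂ x∈ (x∉ ∘ x∈p∪q⁺ ∘ inj₂) (y∉ ∘ x∈p∪q⁺ ∘ inj₂)

  -- rows enumerates members: InCoset recurses on the list, while RowsIndependent and the
  -- rank bound refer to the subset, so only length rows ≤ ∣ members ∣ needs recording.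
  record PartialBasis : Set where
    field
      rows             : List (Fin n)
      members          : Subset n
      members⊆X        : members ⊆ X
      independent      : RowsIndependent G X members
      length≤∣members∣ : length rows ≤ ∣ members ∣
      spans            : ∀ c {T} → T ⊆ members → InCoset c rows (c ⊕ rowSum G X T)

  emptyBasis : PartialBasis
  emptyBasis = record
    { rows             = []
    ; members          = ⊥
    ; members⊆X        = ⊥⊆
    ; independent      = λ T T⊆⊥ (x , x∈T) → contradiction (T⊆⊥ x∈T) ∉⊥
    ; length≤∣members∣ = z≤n
    ; spans            = λ c {T} T⊆⊥ y →
        trans (cong (c y xor_) (rowSum-empty {T} (λ x → ∉⇒lookup≡false (∉⊥ ∘ T⊆⊥)) y))
              (xor-identityʳ (c y))
    }

  module _ (β : PartialBasis) {v : Fin n} (v∈X : v ∈ X)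
           (v∉span : ¬ InCoset 0ᵥ (PartialBasis.rows β) (cutRow G X v)) where

    open PartialBasis β

    v∉members : v ∉ members
    v∉members v∈members =
      v∉span (InCoset-resp 0ᵥ rows (rowSum-⁅⁆ v) (spans 0ᵥ (⁅x⁆⊆p v∈members)))

    independent-extend : RowsIndependent G X (members ∪ ⁅ v ⁆)
    independent-extend T T⊆ T≢∅ with v ∈? T
    ... | no v∉T = independent T (⊆∪⁅⁆∧∉⇒⊆ T⊆ v∉T) T≢∅
    ... | yes v∈T with someTrue⊎≗0ᵥ (rowSum G X T)
    ...   | inj₁ nonzero = nonzero
    ...   | inj₂ sum≗0   =
      contradiction (InCoset-resp 0ᵥ rows rest≗v (spans 0ᵥ (⊆∪⁅⁆⇒-⊆ T⊆))) v∉span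
      where
      rest≗v : rowSum G X (T - v) ≗ cutRow G X v
      rest≗v y = sym (xor≡false⇒≡ (trans (sym (rowSum-split v∈T y)) (sum≗0 y)))

    spans-extend : ∀ c {T} → T ⊆ members ∪ ⁅ v ⁆ → InCoset c (v ∷ rows) (c ⊕ rowSum G X T)
    spans-extend c {T} T⊆ with v ∈? T
    ... | no v∉T  = inj₁ (spans c (⊆∪⁅⁆∧∉⇒⊆ T⊆ v∉T))
    ... | yes v∈T =
      inj₂ (InCoset-resp (c ⊕ cutRow G X v) rows reassoc (spans (c ⊕ cutRow G X v) (⊆∪⁅⁆⇒-⊆ T⊆)))
      where
      reassoc : c ⊕ cutRow G X v ⊕ rowSum G X (T - v) ≗ c ⊕ rowSum G X T
      reassoc y = trans (xor-assoc (c y) _ _) (cong (c y xor_) (sym (rowSum-split v∈T y)))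

    extend : PartialBasis
    extend = record
      { rows             = v ∷ rows
      ; members          = members ∪ ⁅ v ⁆
      ; members⊆X        = [ members⊆X , ⁅x⁆⊆p v∈X ]′ ∘ x∈p∪q⁻ members ⁅ v ⁆
      ; independent      = independent-extend
      ; length≤∣members∣ = ≤-trans (s≤s length≤∣members∣) (x∉p⇒∣p∣<∣p∪⁅x⁆∣ v∉members)
      ; spans            = spans-extend
      }

  SpansRowsOf : List (Fin n) → PartialBasis → Set
  SpansRowsOf vs β = ∀ {x} → x ∈ₗ vs → x ∈ X → InCoset 0ᵥ (PartialBasis.rows β) (cutRow G X x)

  greedyBasis : (vs : List (Fin n)) → Σ PartialBasis (SpansRowsOf vs)
  greedyBasis []       = emptyBasis , λ ()
  greedyBasis (v ∷ vs) with greedyBasis vs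
  ... | β , spansVs with v ∈? X | inCoset? 0ᵥ (PartialBasis.rows β) (cutRow G X v)
  ... | no v∉X    | _          =
    β , λ { (here refl) v∈X → contradiction v∈X v∉X ; (there x∈vs) → spansVs x∈vs }
  ... | yes _     | yes v∈span =
    β , λ { (here refl) _ → v∈span ; (there x∈vs) → spansVs x∈vs }
  ... | yes v∈X   | no v∉span  =
    extend β v∈X v∉span , λ
      { (here refl) _    → inj₂ (InCoset-refl (cutRow G X v) (PartialBasis.rows β))
      ; (there x∈vs) x∈X → inj₁ (spansVs x∈vs x∈X)
      }

  spanningRows : ∀ {r} → RankAtMost G X r →
    ∃ λ bs → length bs ≤ r × (∀ {x} → x ∈ X → InCoset 0ᵥ bs (cutRow G X x))
  spanningRows rank with greedyBasis (allFin n)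
  ... | β , spansAll =
    rows , ≤-trans length≤∣members∣ (rank members members⊆X independent) , spansAll (∈-allFin _)
    where open PartialBasis β

  cover⇒separation : ∀ {S} → CutCover (_∈ X) S →
    IsSeparation G (X ∪ S) (∁ X ∪ S) × Captured X (X ∪ S) (∁ X ∪ S) ×
    order (X ∪ S) (∁ X ∪ S) ≤ ∣ S ∣
  cover⇒separation {S} cover = (covering , noEdge) , (L─R⊆X , p⊆p∪q S) , p⊆q⇒∣p∣≤∣q∣ L∩R⊆S
    where
    covering : ∀ v → v ∈ (X ∪ S) ∪ (∁ X ∪ S)
    covering v with v ∈? X
    ... | yes v∈X = x∈p∪q⁺ (inj₁ (x∈p∪q⁺ (inj₁ v∈X)))
    ... | no  v∉X = x∈p∪q⁺ (inj₂ (x∈p∪q⁺ (inj₁ (x∉p⇒x∈∁p v∉X))))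

    L─R⊆X : (X ∪ S) ─ (∁ X ∪ S) ⊆ X
    L─R⊆X u∈L─R with x∈p∪q⁻ X S (p─q⊆p _ _ u∈L─R)
    ... | inj₁ u∈X = u∈X
    ... | inj₂ u∈S = contradiction (x∈p∪q⁺ (inj₂ u∈S)) (x∈p─q⇒x∉q u∈L─R)

    L∩R⊆S : (X ∪ S) ∩ (∁ X ∪ S) ⊆ S
    L∩R⊆S u∈L∩R with x∈p∩q⁻ (X ∪ S) (∁ X ∪ S) u∈L∩R
    ... | u∈L , u∈R with x∈p∪q⁻ X S u∈L | x∈p∪q⁻ (∁ X) S u∈R
    ...   | inj₂ u∈S | _         = u∈S
    ...   | _        | inj₂ u∈S  = u∈S
    ...   | inj₁ u∈X | inj₁ u∈∁X = contradiction u∈X (x∈∁p⇒x∉p u∈∁X)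

    noEdge : ∀ u v → u ∈ (X ∪ S) ─ (∁ X ∪ S) → v ∈ (∁ X ∪ S) ─ (X ∪ S) → adj G u v ≡ false
    noEdge u v u∈L─R v∈R─L = begin
      adj G u v              ≡⟨ ∧-identityʳ (adj G u v) ⟨
      adj G u v ∧ not false  ≡⟨ cong (λ b → adj G u v ∧ not b) (∉⇒lookup≡false v∉X) ⟨
      cutRow G X u v         ≡⟨ cover (L─R⊆X u∈L─R) (x∈p─q⇒x∉q u∈L─R ∘ x∈p∪q⁺ ∘ inj₂) v∉S ⟩
      false                  ∎
      where
      open ≡-Reasoning
      v∉X : v ∉ X
      v∉X = x∈p─q⇒x∉q v∈R─L ∘ x∈p∪q⁺ ∘ inj₁
      v∉S : v ∉ S
      v∉S = x∈p─q⇒x∉q v∈R─L ∘ x∈p∪q⁺ ∘ inj₂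

lemma4p1 : ∀ {n} (G : Graph n) (t r : ℕ) (X : Subset n) →
    ¬ ContainsKtt G t → RankAtMost G X r →
    Σ (Subset n) λ L → Σ (Subset n) λ R →
      IsSeparation G L R × Captured X L R × order L R ≤ 2 ^ (r + 1) * (t ∸ 1)
lemma4p1 G t r X noKtt rank =
  let bs , length≤r , spanning          = spanningRows G X rank
      S , ∣S∣≤ , cover                  = cosetCover G X noKtt bs 0ᵥ
      separation , captured , order≤∣S∣ = cover⇒separation G X (cover ∘ spanning)
  in  X ∪ S , ∁ X ∪ S , separation , captured , (begin
        order (X ∪ S) (∁ X ∪ S)  ≤⟨ order≤∣S∣ ⟩
        ∣ S ∣                    ≤⟨ ∣S∣≤ ⟩
        2 ^ length bs * (t ∸ 1)  ≤⟨ *-monoˡ-≤ (t ∸ 1) (^-monoʳ-≤ 2 (≤-trans length≤r (m≤m+n r 1))) ⟩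
        2 ^ (r + 1) * (t ∸ 1)    ∎)
  where open ≤-Reasoning
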